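{- Let $P,Q$ be rational polygons of denominator $d$ and $d'$ a positive integer divisible by $d$. If $W_{d'}(P) = W_{d'}(Q)$, then $W_d(P)=W_d(Q)$.
   Context: A rational polygon (not necessarily convex) has denominator $d$ if $d$ is the least positive integer with $dP$ having integer vertices. For a positive integer $n$, a segment with endpoints in $\frac{1}{n}\mathbb{Z}^2$ is $n$-minimal if it contains no other points of $\frac{1}{n}\mathbb{Z}^2$; for an oriented $n$-minimal segment from $p=(w/n,x/n)$ to $q=(y/n,z/n)$ its weight is $wz-xy \bmod n$. For $n$ divisible by the denominator of $P$, with the boundary of $P$ oriented counterclockwise it is uniquely a union of oriented $n$-minimal segments, and $W_{n}(P)$ is the multiset of their weights (residues mod $n$). -}

module Defs where

open import Data.Nat as ℕ using (ℕ; zero; suc)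
open import Data.Nat.DivMod using (m%n<n)
open import Data.Nat.GCD using (gcd)
open import Data.Integer as ℤ using (ℤ; +_)
open import Data.Integer.DivMod using (_/ℕ_; _%ℕ_)
open import Data.Rational as ℚ using (ℚ; ↥_; ↧ₙ_; 0ℚ; 1ℚ)
open import Data.Fin using (Fin; toℕ; fromℕ<)
open import Data.List using (List; []; _∷_; map; concatMap; upTo; allFin; foldr)
open import Data.Product using (_×_; _,_; proj₁; proj₂; ∃)
open import Data.Sum using (_⊎_)
open import Relation.Binary.PropositionalEquality using (_≡_; _≢_)

Point : Set
Point = ℚ × ℚ

ℤPoint : Set
ℤPoint = ℤ × ℤ

detℚ : Point → Point → ℚ
detℚ (a , b) (c , d) = a ℚ.* d ℚ.- b ℚ.* c

_-ᵖ_ : Point → Point → Point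
(a , b) -ᵖ (c , d) = (a ℚ.- c , b ℚ.- d)

next : ∀ {k} → Fin (suc k) → Fin (suc k)
next {k} i = fromℕ< (m%n<n (suc (toℕ i)) (suc k))

OnSegment : Point → Point → Point → Set
OnSegment (p₁ , p₂) (a₁ , a₂) (b₁ , b₂) =
  ∃ λ (t : ℚ) → (0ℚ ℚ.≤ t) × (t ℚ.≤ 1ℚ)
    × (p₁ ≡ a₁ ℚ.+ t ℚ.* (b₁ ℚ.- a₁))
    × (p₂ ≡ a₂ ℚ.+ t ℚ.* (b₂ ℚ.- a₂))

record RatPolygon : Set where
  field
    size-3 : ℕ            -- number of vertices is size-3 + 3
  k-1 : ℕ
  k-1 = suc (suc size-3)
  field
    vert   : Fin (suc k-1) → Point
    -- consecutive edges are not collinear (every listed vertex is a genuine corner;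
    -- in particular no edge is degenerate)
    corner : ∀ i → detℚ (vert (next i) -ᵖ vert i) (vert (next (next i)) -ᵖ vert (next i)) ≢ 0ℚ
    -- the closed polygonal curve is simple: two distinct edges meet only in the
    -- common vertex of adjacent edges
    simple : ∀ i j → i ≢ j → ∀ p → OnSegment p (vert i) (vert (next i))
               → OnSegment p (vert j) (vert (next j))
               → (j ≡ next i × p ≡ vert j) ⊎ (i ≡ next j × p ≡ vert i)
    -- the boundary is oriented counterclockwise (positive signed area, shoelace)
    ccw    : 0ℚ ℚ.< foldr ℚ._+_ 0ℚ (map (λ i → detℚ (vert i) (vert (next i))) (allFin (suc k-1)))

open RatPolygon public

scale : ℕ → ℚ → ℚ
scale e q = (+ e ℚ./ 1) ℚ.* q

IsInteger : ℚ → Set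
IsInteger q = ↧ₙ q ≡ 1

ScaledIntegral : ℕ → RatPolygon → Set
ScaledIntegral e P = ∀ i → IsInteger (scale e (proj₁ (vert P i))) × IsInteger (scale e (proj₂ (vert P i)))

HasDenominator : RatPolygon → ℕ → Set
HasDenominator P d = (0 ℕ.< d) × ScaledIntegral d P × (∀ e → 0 ℕ.< e → ScaledIntegral e P → d ℕ.≤ e)

-- reduction of an integer modulo n (n = 0 never used: n is positive below)
modn : ℤ → ℕ → ℕ
modn z zero    = 0
modn z (suc m) = z %ℕ suc m

-- the integer n·q (meaningful when n·q is an integer)
intScale : ℕ → ℚ → ℤ
intScale n q = ↥ (scale n q)

nCoords : ℕ → Point → ℤPoint
nCoords n (x , y) = (intScale n x , intScale n y)

-- weight of the oriented n-minimal segment from p = (w/n, x/n) to q = (y/n, z/n),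
-- given by integer coordinates (w,x), (y,z): wz - xy mod n
weight : ℕ → ℤPoint → ℤPoint → ℕ
weight n (w , x) (y , z) = modn (w ℤ.* z ℤ.- x ℤ.* y) n

divBy : ℤ → ℕ → ℤ
divBy z zero    = z
divBy z (suc g) = z /ℕ suc g

-- the n-minimal segments subdividing the segment from A to B (in integer
-- coordinates of ℤ² ≅ (1/n)ℤ²): with g = gcd of the coordinate differences and
-- δ = (B - A)/g, these are the segments from A + jδ to A + (j+1)δ, j < g.
minimalSegments : ℤPoint → ℤPoint → List (ℤPoint × ℤPoint)
minimalSegments (a₁ , a₂) (b₁ , b₂) =
  map (λ j → (pt j , pt (suc j))) (upTo g)
  where
  dx = b₁ ℤ.- a₁
  dy = b₂ ℤ.- a₂
  g  = gcd ℤ.∣ dx ∣ ℤ.∣ dy ∣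
  δ₁ = divBy dx g
  δ₂ = divBy dy g
  pt : ℕ → ℤPoint
  pt j = (a₁ ℤ.+ (+ j) ℤ.* δ₁ , a₂ ℤ.+ (+ j) ℤ.* δ₂)

-- W_n(P): the list (multiset, up to permutation) of the weights of the oriented
-- n-minimal segments composing the counterclockwise boundary of P.
W : ℕ → RatPolygon → List ℕ
W n P = concatMap edgeWeights (allFin (suc (k-1 P)))
  where
  edgeWeights : Fin (suc (k-1 P)) → List ℕ
  edgeWeights i = map (λ s → weight n (proj₁ s) (proj₂ s))
                      (minimalSegments (nCoords n (vert P i)) (nCoords n (vert P (next i))))

-- Write d′ = m d. The (1/d′)-lattice coordinates of P are m times its (1/d)-lattice
-- coordinates, so an edge made of g d-minimal pieces with primitive step δ starting at A
-- is made of m g d′-minimal pieces with the same step δ starting at m A. All pieces of a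
-- lattice segment have the weight det(start, δ), and det(m A, δ) mod m d is
-- m (det(A, δ) mod d). Dividing W_{d′} by m therefore yields W_d with every multiplicity
-- multiplied by m, and that m-fold multiset determines W_d up to permutation.
module Submission where

open import Defs
open import Data.Nat using (ℕ; _<_)
open import Data.Nat.Divisibility using (_∣_)
open import Data.List.Relation.Binary.Permutation.Propositional using (_↭_)

open import Algebra using (AbelianGroup)
open import Data.Nat as ℕ using (zero; suc; NonZero)
import Data.Nat.Properties as ℕ
open import Data.Nat.Divisibility using (divides)
open import Data.Nat.DivMod using (m*n/n≡m)
open import Data.Nat.GCD using (gcd; c*gcd[m,n]≡gcd[cm,cn])
open import Data.Integer as ℤ using (ℤ; +_)
import Data.Integer.Properties as ℤ
open import Data.Integer.DivMod using (_/ℕ_; _%ℕ_; a≡a%ℕn+[a/ℕn]*n; n%ℕd<d)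
import Data.Integer.GCD as ℤ
open import Data.Integer.Tactic.RingSolver using (solve-∀)
open import Data.Rational as ℚ using (mkℚ; ↥_)
import Data.Rational.Properties as ℚ
open import Data.Fin using (Fin)
open import Data.List using (List; []; _∷_; _++_; map; concatMap; replicate; upTo; length; allFin)
import Data.List.Properties as List
open import Data.List.Membership.Propositional using (_∈_)
open import Data.List.Membership.Propositional.Properties using (∈-concatMap⁻; ∈-∃++)
import Data.List.Relation.Unary.All as All
import Data.List.Relation.Unary.All.Properties as All
import Data.List.Relation.Unary.Any as Any
open import Data.List.Relation.Binary.Permutation.Propositional
  using (↭-refl; ↭-sym; ↭-trans; prep; module PermutationReasoning)
open import Data.List.Relation.Binary.Permutation.Propositional.Properties
  using (map⁺; drop-∷; shift; shifts; ↭-empty-inv; ∈-resp-↭)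
open import Data.Product using (_×_; _,_; proj₁; proj₂; uncurry)
open import Function using (_∘_)
open import Data.Empty using (⊥-elim)
open import Relation.Binary.Definitions using (tri<; tri≈; tri>)
open import Relation.Binary.PropositionalEquality
open import Algebra.Properties.Group (AbelianGroup.group ℤ.+-0-abelianGroup) using (∙-cancelʳ)

r+q*k<r′+q′*k : ∀ {k r r′ q q′} → r ℕ.< k → q ℤ.< q′ →
                + r ℤ.+ q ℤ.* + k ℤ.< + r′ ℤ.+ q′ ℤ.* + k
r+q*k<r′+q′*k {k} {r} {r′} {q} {q′} r<k q<q′ = begin-strict
  + r ℤ.+ q ℤ.* + k   <⟨ ℤ.+-monoˡ-< (q ℤ.* + k) (ℤ.+<+ r<k) ⟩
  + k ℤ.+ q ℤ.* + k   ≡⟨ ℤ.suc-* q (+ k) ⟨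
  ℤ.suc q ℤ.* + k     ≤⟨ ℤ.*-monoʳ-≤-nonNeg (+ k) (ℤ.i<j⇒suc[i]≤j q<q′) ⟩
  q′ ℤ.* + k          ≤⟨ ℤ.i≤j+i _ (+ r′) ⟩
  + r′ ℤ.+ q′ ℤ.* + k ∎
  where open ℤ.≤-Reasoning

divMod-unique : ∀ {a q r} k .{{_ : NonZero k}} → r ℕ.< k → a ≡ + r ℤ.+ q ℤ.* + k →
                a %ℕ k ≡ r × a /ℕ k ≡ q
divMod-unique {a} {q} {r} k r<k a≡r+q*k with ℤ.<-cmp q (a /ℕ k)
... | tri< q<a/k _ _ = ⊥-elim (ℤ.<-irrefl (trans (sym a≡r+q*k) (a≡a%ℕn+[a/ℕn]*n a k))
                                          (r+q*k<r′+q′*k r<k q<a/k))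
... | tri> _ _ a/k<q = ⊥-elim (ℤ.<-irrefl (trans (sym (a≡a%ℕn+[a/ℕn]*n a k)) a≡r+q*k)
                                          (r+q*k<r′+q′*k (n%ℕd<d a k) a/k<q))
... | tri≈ _ q≡a/k _ = ℤ.+-injective a%k≡r , sym q≡a/k
  where
  a-expansions : + (a %ℕ k) ℤ.+ q ℤ.* + k ≡ + r ℤ.+ q ℤ.* + k
  a-expansions = begin
    + (a %ℕ k) ℤ.+ q ℤ.* + k         ≡⟨ cong (λ t → + (a %ℕ k) ℤ.+ t ℤ.* + k) q≡a/k ⟩
    + (a %ℕ k) ℤ.+ (a /ℕ k) ℤ.* + k  ≡⟨ a≡a%ℕn+[a/ℕn]*n a k ⟨
    a                                ≡⟨ a≡r+q*k ⟩
    + r ℤ.+ q ℤ.* + k                ∎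
    where open ≡-Reasoning
  a%k≡r : + (a %ℕ k) ≡ + r
  a%k≡r = ∙-cancelʳ (q ℤ.* + k) (+ (a %ℕ k)) (+ r) a-expansions

[m*i]%ℕ[m*k]×[m*i]/ℕ[m*k] : ∀ m k .{{_ : NonZero k}} .{{_ : NonZero (m ℕ.* k)}} i →
  (+ m ℤ.* i) %ℕ (m ℕ.* k) ≡ m ℕ.* (i %ℕ k) × (+ m ℤ.* i) /ℕ (m ℕ.* k) ≡ i /ℕ k
[m*i]%ℕ[m*k]×[m*i]/ℕ[m*k] m k i =
  divMod-unique (m ℕ.* k) (ℕ.*-monoʳ-< m {{ℕ.m*n≢0⇒m≢0 m}} (n%ℕd<d i k)) (begin
    + m ℤ.* i                                      ≡⟨ cong (+ m ℤ.*_) (a≡a%ℕn+[a/ℕn]*n i k) ⟩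
    + m ℤ.* (+ r ℤ.+ q ℤ.* + k)                    ≡⟨ distrib (+ m) (+ r) q (+ k) ⟩
    + m ℤ.* + r ℤ.+ q ℤ.* (+ m ℤ.* + k)            ≡⟨ cong₂ (λ s t → s ℤ.+ q ℤ.* t) (ℤ.pos-* m r) (ℤ.pos-* m k) ⟨
    + (m ℕ.* r) ℤ.+ q ℤ.* + (m ℕ.* k)              ∎)
  where
  open ≡-Reasoning
  r = i %ℕ k
  q = i /ℕ k
  distrib : ∀ m r q k → m ℤ.* (r ℤ.+ q ℤ.* k) ≡ m ℤ.* r ℤ.+ q ℤ.* (m ℤ.* k)
  distrib = solve-∀

↥[i/1]≡i : ∀ i → ↥ (i ℚ./ 1) ≡ i
↥[i/1]≡i i = trans (sym (ℤ.*-identityʳ _))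
                   (trans (cong (↥ (i ℚ./ 1) ℤ.*_) (sym (ℤ.gcd-zeroʳ i))) (ℚ.↥-/ i 1))

i/1-isInteger : ∀ i → IsInteger (i ℚ./ 1)
i/1-isInteger i = ℤ.+-injective (trans (sym (ℤ.*-identityʳ _))
                    (trans (cong (ℚ.↧ (i ℚ./ 1) ℤ.*_) (sym (ℤ.gcd-zeroʳ i))) (ℚ.↧-/ i 1)))

*-integer : ∀ p q → IsInteger p → IsInteger q → p ℚ.* q ≡ (↥ p ℤ.* ↥ q) ℚ./ 1
*-integer (mkℚ _ _ _) (mkℚ _ _ _) refl refl = refl

scale-integer : ∀ m q → IsInteger q → scale m q ≡ (+ m ℤ.* ↥ q) ℚ./ 1
scale-integer m q q∈ℤ = trans (*-integer (+ m ℚ./ 1) q (i/1-isInteger (+ m)) q∈ℤ)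
                              (cong (λ i → (i ℤ.* ↥ q) ℚ./ 1) (↥[i/1]≡i (+ m)))

scale-* : ∀ m d q → scale (m ℕ.* d) q ≡ scale m (scale d q)
scale-* m d q = begin
  (+ (m ℕ.* d) ℚ./ 1) ℚ.* q                      ≡⟨ cong (λ i → (i ℚ./ 1) ℚ.* q) (ℤ.pos-* m d) ⟩
  ((+ m ℤ.* + d) ℚ./ 1) ℚ.* q                    ≡⟨ cong (λ i → ((+ m ℤ.* i) ℚ./ 1) ℚ.* q) (↥[i/1]≡i (+ d)) ⟨
  ((+ m ℤ.* ↥ (+ d ℚ./ 1)) ℚ./ 1) ℚ.* q          ≡⟨ cong (ℚ._* q) (scale-integer m (+ d ℚ./ 1) (i/1-isInteger (+ d))) ⟨
  ((+ m ℚ./ 1) ℚ.* (+ d ℚ./ 1)) ℚ.* q            ≡⟨ ℚ.*-assoc (+ m ℚ./ 1) (+ d ℚ./ 1) q ⟩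
  (+ m ℚ./ 1) ℚ.* ((+ d ℚ./ 1) ℚ.* q)            ∎
  where open ≡-Reasoning

intScale-* : ∀ m d q → IsInteger (scale d q) → intScale (m ℕ.* d) q ≡ + m ℤ.* intScale d q
intScale-* m d q dq∈ℤ = begin
  ↥ scale (m ℕ.* d) q                  ≡⟨ cong ↥_ (scale-* m d q) ⟩
  ↥ scale m (scale d q)                ≡⟨ cong ↥_ (scale-integer m (scale d q) dq∈ℤ) ⟩
  ↥ ((+ m ℤ.* intScale d q) ℚ./ 1)     ≡⟨ ↥[i/1]≡i _ ⟩
  + m ℤ.* intScale d q                 ∎
  where open ≡-Reasoning

expand : ℕ → List ℕ → List ℕ
expand m = concatMap (replicate m)

replicate-+ : ∀ a b (x : ℕ) → replicate (a ℕ.+ b) x ≡ replicate a x ++ replicate b x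
replicate-+ zero    b x = refl
replicate-+ (suc a) b x = cong (x ∷_) (replicate-+ a b x)

expand-replicate : ∀ m g (x : ℕ) → expand m (replicate g x) ≡ replicate (g ℕ.* m) x
expand-replicate m zero    x = refl
expand-replicate m (suc g) x = trans (cong (replicate m x ++_) (expand-replicate m g x))
                                     (sym (replicate-+ m (g ℕ.* m) x))

∈-replicate⁻ : ∀ m {x y : ℕ} → x ∈ replicate m y → x ≡ y
∈-replicate⁻ m {y = y} = All.lookup (All.replicate⁺ {P = _≡ y} m refl)

∈-expand⁻ : ∀ m {x : ℕ} ys → x ∈ expand m ys → x ∈ ys
∈-expand⁻ m ys x∈ = Any.map (∈-replicate⁻ m) (∈-concatMap⁻ (replicate m) {xs = ys} x∈)

++-cancelˡ-↭ : ∀ (zs : List ℕ) {xs ys} → zs ++ xs ↭ zs ++ ys → xs ↭ ys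
++-cancelˡ-↭ []       p = p
++-cancelˡ-↭ (z ∷ zs) p = ++-cancelˡ-↭ zs (drop-∷ p)

expand-cancel : ∀ m .{{_ : NonZero m}} xs ys → expand m xs ↭ expand m ys → xs ↭ ys
expand-cancel m []       []       p = ↭-refl
expand-cancel m@(suc _) [] (y ∷ ys) p with () ← ↭-empty-inv (↭-sym p)
expand-cancel m@(suc _) (x ∷ xs) ys p
  with as , bs , refl ← ∈-∃++ (∈-expand⁻ m ys (∈-resp-↭ p (Any.here refl)))
  = ↭-trans (prep x (expand-cancel m xs (as ++ bs) (++-cancelˡ-↭ (replicate m x) x-block-first)))
            (↭-sym (shift x as bs))
  where
  open PermutationReasoning
  x-block-first : replicate m x ++ expand m xs ↭ replicate m x ++ expand m (as ++ bs)
  x-block-first = begin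
    replicate m x ++ expand m xs                      ↭⟨ p ⟩
    expand m (as ++ x ∷ bs)                           ≡⟨ List.concatMap-++ (replicate m) as (x ∷ bs) ⟩
    expand m as ++ replicate m x ++ expand m bs       ↭⟨ shifts (expand m as) (replicate m x) ⟩
    replicate m x ++ expand m as ++ expand m bs       ≡⟨ cong (replicate m x ++_) (List.concatMap-++ (replicate m) as bs) ⟨
    replicate m x ++ expand m (as ++ bs)              ∎

expand-concatMap : ∀ {A : Set} m (f : A → List ℕ) xs →
                   expand m (concatMap f xs) ≡ concatMap (expand m ∘ f) xs
expand-concatMap m f []       = refl
expand-concatMap m f (x ∷ xs) = trans (List.concatMap-++ (replicate m) (f x) (concatMap f xs))
                                      (cong (expand m (f x) ++_) (expand-concatMap m f xs))

_·ℤ²_ : ℕ → ℤPoint → ℤPoint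
m ·ℤ² (x , y) = (+ m ℤ.* x , + m ℤ.* y)

latticeLength : ℤPoint → ℤPoint → ℕ
latticeLength (a₁ , a₂) (b₁ , b₂) = gcd ℤ.∣ b₁ ℤ.- a₁ ∣ ℤ.∣ b₂ ℤ.- a₂ ∣

primitiveStep : ℤPoint → ℤPoint → ℤPoint
primitiveStep A@(a₁ , a₂) B@(b₁ , b₂) =
  divBy (b₁ ℤ.- a₁) (latticeLength A B) , divBy (b₂ ℤ.- a₂) (latticeLength A B)

segmentWeights : ℕ → ℤPoint → ℤPoint → List ℕ
segmentWeights n A B = map (uncurry (weight n)) (minimalSegments A B)

map-const : ∀ {A B : Set} (c : B) (xs : List A) → map (λ _ → c) xs ≡ replicate (length xs) c
map-const c []       = refl
map-const c (x ∷ xs) = cong (c ∷_) (map-const c xs)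

-- Consecutive lattice points A + jδ, A + (j+1)δ span the same determinant det(A, δ).
segmentWeights≡replicate : ∀ n A B →
  segmentWeights n A B ≡ replicate (latticeLength A B) (weight n A (primitiveStep A B))
segmentWeights≡replicate n A@(a₁ , a₂) B@(_ , _) = begin
  map (uncurry (weight n)) (map (λ j → pt j , pt (suc j)) (upTo g))  ≡⟨ List.map-∘ (upTo g) ⟨
  map (λ j → weight n (pt j) (pt (suc j))) (upTo g)                  ≡⟨ List.map-cong piece (upTo g) ⟩
  map (λ _ → weight n A δ) (upTo g)                                  ≡⟨ map-const (weight n A δ) (upTo g) ⟩
  replicate (length (upTo g)) (weight n A δ)                         ≡⟨ cong (λ k → replicate k (weight n A δ)) (List.length-upTo g) ⟩
  replicate g (weight n A δ)                                         ∎
  where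
  open ≡-Reasoning
  g = latticeLength A B
  δ = primitiveStep A B
  pt : ℕ → ℤPoint
  pt j = a₁ ℤ.+ + j ℤ.* proj₁ δ , a₂ ℤ.+ + j ℤ.* proj₂ δ
  det-step : ∀ a₁ a₂ δ₁ δ₂ j →
    (a₁ ℤ.+ j ℤ.* δ₁) ℤ.* (a₂ ℤ.+ (ℤ.1ℤ ℤ.+ j) ℤ.* δ₂) ℤ.- (a₂ ℤ.+ j ℤ.* δ₂) ℤ.* (a₁ ℤ.+ (ℤ.1ℤ ℤ.+ j) ℤ.* δ₁)
    ≡ a₁ ℤ.* δ₂ ℤ.- a₂ ℤ.* δ₁
  det-step = solve-∀
  piece : ∀ j → weight n (pt j) (pt (suc j)) ≡ weight n A δ
  piece j rewrite ℤ.pos-+ 1 j = cong (λ t → modn t n) (det-step a₁ a₂ (proj₁ δ) (proj₂ δ) (+ j))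

modn≡%ℕ : ∀ z n .{{_ : NonZero n}} → modn z n ≡ z %ℕ n
modn≡%ℕ z (suc n) = refl

divBy≡/ℕ : ∀ z g .{{_ : NonZero g}} → divBy z g ≡ z /ℕ g
divBy≡/ℕ z (suc g) = refl

weight-scaleˡ : ∀ m n .{{_ : NonZero m}} .{{_ : NonZero n}} A δ →
                weight (m ℕ.* n) (m ·ℤ² A) δ ≡ m ℕ.* weight n A δ
weight-scaleˡ m n (a₁ , a₂) (δ₁ , δ₂) = begin
  modn (+ m ℤ.* a₁ ℤ.* δ₂ ℤ.- + m ℤ.* a₂ ℤ.* δ₁) (m ℕ.* n)  ≡⟨ modn≡%ℕ _ (m ℕ.* n) ⟩
  (+ m ℤ.* a₁ ℤ.* δ₂ ℤ.- + m ℤ.* a₂ ℤ.* δ₁) %ℕ (m ℕ.* n)   ≡⟨ cong (_%ℕ (m ℕ.* n)) (factor (+ m) a₁ a₂ δ₁ δ₂) ⟩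
  (+ m ℤ.* (a₁ ℤ.* δ₂ ℤ.- a₂ ℤ.* δ₁)) %ℕ (m ℕ.* n)         ≡⟨ proj₁ ([m*i]%ℕ[m*k]×[m*i]/ℕ[m*k] m n _) ⟩
  m ℕ.* ((a₁ ℤ.* δ₂ ℤ.- a₂ ℤ.* δ₁) %ℕ n)                   ≡⟨ cong (m ℕ.*_) (modn≡%ℕ _ n) ⟨
  m ℕ.* modn (a₁ ℤ.* δ₂ ℤ.- a₂ ℤ.* δ₁) n                   ∎
  where
  open ≡-Reasoning
  factor : ∀ m a₁ a₂ δ₁ δ₂ → m ℤ.* a₁ ℤ.* δ₂ ℤ.- m ℤ.* a₂ ℤ.* δ₁ ≡ m ℤ.* (a₁ ℤ.* δ₂ ℤ.- a₂ ℤ.* δ₁)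
  factor = solve-∀
  instance
    mn≢0 : NonZero (m ℕ.* n)
    mn≢0 = ℕ.m*n≢0 m n

divBy-scale : ∀ m g .{{_ : NonZero m}} .{{_ : NonZero g}} z → divBy (+ m ℤ.* z) (m ℕ.* g) ≡ divBy z g
divBy-scale m g z = begin
  divBy (+ m ℤ.* z) (m ℕ.* g)  ≡⟨ divBy≡/ℕ _ (m ℕ.* g) ⟩
  (+ m ℤ.* z) /ℕ (m ℕ.* g)     ≡⟨ proj₂ ([m*i]%ℕ[m*k]×[m*i]/ℕ[m*k] m g z) ⟩
  z /ℕ g                       ≡⟨ divBy≡/ℕ z g ⟨
  divBy z g                    ∎
  where
  open ≡-Reasoning
  instance
    mg≢0 : NonZero (m ℕ.* g)
    mg≢0 = ℕ.m*n≢0 m g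

*-distribˡ-- : ∀ m a b → m ℤ.* b ℤ.- m ℤ.* a ≡ m ℤ.* (b ℤ.- a)
*-distribˡ-- = solve-∀

latticeLength-scale : ∀ m A B → latticeLength (m ·ℤ² A) (m ·ℤ² B) ≡ m ℕ.* latticeLength A B
latticeLength-scale m (a₁ , a₂) (b₁ , b₂) = begin
  gcd ℤ.∣ + m ℤ.* b₁ ℤ.- + m ℤ.* a₁ ∣ ℤ.∣ + m ℤ.* b₂ ℤ.- + m ℤ.* a₂ ∣
    ≡⟨ cong₂ gcd (∣m*b-m*a∣ a₁ b₁) (∣m*b-m*a∣ a₂ b₂) ⟩
  gcd (m ℕ.* ℤ.∣ b₁ ℤ.- a₁ ∣) (m ℕ.* ℤ.∣ b₂ ℤ.- a₂ ∣)
    ≡⟨ c*gcd[m,n]≡gcd[cm,cn] m _ _ ⟨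
  m ℕ.* gcd ℤ.∣ b₁ ℤ.- a₁ ∣ ℤ.∣ b₂ ℤ.- a₂ ∣
    ∎
  where
  open ≡-Reasoning
  ∣m*b-m*a∣ : ∀ a b → ℤ.∣ + m ℤ.* b ℤ.- + m ℤ.* a ∣ ≡ m ℕ.* ℤ.∣ b ℤ.- a ∣
  ∣m*b-m*a∣ a b = trans (cong ℤ.∣_∣ (*-distribˡ-- (+ m) a b)) (ℤ.abs-* (+ m) (b ℤ.- a))

primitiveStep-scale : ∀ m .{{_ : NonZero m}} A B .{{_ : NonZero (latticeLength A B)}} →
                      primitiveStep (m ·ℤ² A) (m ·ℤ² B) ≡ primitiveStep A B
primitiveStep-scale m A@(a₁ , a₂) B@(b₁ , b₂) = cong₂ _,_ (coordinate a₁ b₁) (coordinate a₂ b₂)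
  where
  open ≡-Reasoning
  coordinate : ∀ a b → divBy (+ m ℤ.* b ℤ.- + m ℤ.* a) (latticeLength (m ·ℤ² A) (m ·ℤ² B))
                       ≡ divBy (b ℤ.- a) (latticeLength A B)
  coordinate a b = begin
    divBy (+ m ℤ.* b ℤ.- + m ℤ.* a) (latticeLength (m ·ℤ² A) (m ·ℤ² B))
      ≡⟨ cong₂ divBy (*-distribˡ-- (+ m) a b) (latticeLength-scale m A B) ⟩
    divBy (+ m ℤ.* (b ℤ.- a)) (m ℕ.* latticeLength A B)
      ≡⟨ divBy-scale m (latticeLength A B) (b ℤ.- a) ⟩
    divBy (b ℤ.- a) (latticeLength A B)
      ∎

replicate-cong-nonZero : ∀ n {x y : ℕ} → (.{{_ : NonZero n}} → x ≡ y) → replicate n x ≡ replicate n y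
replicate-cong-nonZero zero    x≡y = refl
replicate-cong-nonZero (suc n) x≡y = cong (replicate (suc n)) x≡y

segmentWeights-scale : ∀ m d .{{_ : NonZero m}} .{{_ : NonZero d}} A B →
  map (ℕ._/ m) (segmentWeights (m ℕ.* d) (m ·ℤ² A) (m ·ℤ² B)) ≡ expand m (segmentWeights d A B)
segmentWeights-scale m d A B = begin
  map (ℕ._/ m) (segmentWeights (m ℕ.* d) (m ·ℤ² A) (m ·ℤ² B))
    ≡⟨ cong (map (ℕ._/ m)) (segmentWeights≡replicate (m ℕ.* d) (m ·ℤ² A) (m ·ℤ² B)) ⟩
  map (ℕ._/ m) (replicate (latticeLength (m ·ℤ² A) (m ·ℤ² B)) w′)
    ≡⟨ List.map-replicate (ℕ._/ m) _ w′ ⟩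
  replicate (latticeLength (m ·ℤ² A) (m ·ℤ² B)) (w′ ℕ./ m)
    ≡⟨ cong (λ k → replicate k (w′ ℕ./ m)) (trans (latticeLength-scale m A B) (ℕ.*-comm m g)) ⟩
  replicate (g ℕ.* m) (w′ ℕ./ m)
    -- for a degenerate edge (g = 0) the primitive step is junk, but then the lists are empty
    ≡⟨ replicate-cong-nonZero (g ℕ.* m) (λ {{gm≢0}} → w′/m≡w {{ℕ.m*n≢0⇒m≢0 g {{gm≢0}}}}) ⟩
  replicate (g ℕ.* m) w
    ≡⟨ expand-replicate m g w ⟨
  expand m (replicate g w)
    ≡⟨ cong (expand m) (segmentWeights≡replicate d A B) ⟨
  expand m (segmentWeights d A B)
    ∎
  where
  open ≡-Reasoning
  g = latticeLength A B
  w = weight d A (primitiveStep A B)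
  w′ = weight (m ℕ.* d) (m ·ℤ² A) (primitiveStep (m ·ℤ² A) (m ·ℤ² B))
  w′/m≡w : .{{_ : NonZero g}} → w′ ℕ./ m ≡ w
  w′/m≡w = begin
    w′ ℕ./ m                                                ≡⟨ cong (λ δ → weight (m ℕ.* d) (m ·ℤ² A) δ ℕ./ m) (primitiveStep-scale m A B) ⟩
    weight (m ℕ.* d) (m ·ℤ² A) (primitiveStep A B) ℕ./ m    ≡⟨ cong (ℕ._/ m) (weight-scaleˡ m d A (primitiveStep A B)) ⟩
    m ℕ.* w ℕ./ m                                           ≡⟨ cong (ℕ._/ m) (ℕ.*-comm m w) ⟩
    w ℕ.* m ℕ./ m                                           ≡⟨ m*n/n≡m w m ⟩
    w                                                       ∎

nCoords-* : ∀ m d v → IsInteger (scale d (proj₁ v)) × IsInteger (scale d (proj₂ v)) →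
            nCoords (m ℕ.* d) v ≡ m ·ℤ² nCoords d v
nCoords-* m d (x , y) (dx∈ℤ , dy∈ℤ) = cong₂ _,_ (intScale-* m d x dx∈ℤ) (intScale-* m d y dy∈ℤ)

W-scale : ∀ m d .{{_ : NonZero m}} .{{_ : NonZero d}} P → ScaledIntegral d P →
          map (ℕ._/ m) (W (m ℕ.* d) P) ≡ expand m (W d P)
W-scale m d P dP∈ℤ² = begin
  map (ℕ._/ m) (concatMap (edgeWeights (m ℕ.* d)) vertices)    ≡⟨ List.map-concatMap (ℕ._/ m) (edgeWeights (m ℕ.* d)) vertices ⟩
  concatMap (map (ℕ._/ m) ∘ edgeWeights (m ℕ.* d)) vertices    ≡⟨ List.concatMap-cong edge-scale vertices ⟩
  concatMap (expand m ∘ edgeWeights d) vertices                ≡⟨ expand-concatMap m (edgeWeights d) vertices ⟨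
  expand m (concatMap (edgeWeights d) vertices)                ∎
  where
  open ≡-Reasoning
  vertices = allFin (suc (k-1 P))
  edgeWeights : ℕ → Fin (suc (k-1 P)) → List ℕ
  edgeWeights n i = segmentWeights n (nCoords n (vert P i)) (nCoords n (vert P (next i)))
  edge-scale : ∀ i → map (ℕ._/ m) (edgeWeights (m ℕ.* d) i) ≡ expand m (edgeWeights d i)
  edge-scale i = begin
    map (ℕ._/ m) (edgeWeights (m ℕ.* d) i)
      ≡⟨ cong₂ (λ A B → map (ℕ._/ m) (segmentWeights (m ℕ.* d) A B))
               (nCoords-* m d (vert P i) (dP∈ℤ² i)) (nCoords-* m d (vert P (next i)) (dP∈ℤ² (next i))) ⟩
    map (ℕ._/ m) (segmentWeights (m ℕ.* d) (m ·ℤ² nCoords d (vert P i)) (m ·ℤ² nCoords d (vert P (next i))))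
      ≡⟨ segmentWeights-scale m d (nCoords d (vert P i)) (nCoords d (vert P (next i))) ⟩
    expand m (edgeWeights d i)
      ∎

mainTheorem12 : (P Q : RatPolygon) (d d′ : ℕ) → HasDenominator P d → HasDenominator Q d
    → 0 < d′ → d ∣ d′ → W d′ P ↭ W d′ Q → W d P ↭ W d Q
mainTheorem12 P Q d .(m ℕ.* d) (0<d , dP∈ℤ² , _) (_ , dQ∈ℤ² , _) 0<md (divides m refl) W′P↭W′Q =
  expand-cancel m (W d P) (W d Q)
    (subst₂ _↭_ (W-scale m d P dP∈ℤ²) (W-scale m d Q dQ∈ℤ²) (map⁺ (ℕ._/ m) W′P↭W′Q))
  where instance
    d≢0 : NonZero d
    d≢0 = ℕ.>-nonZero 0<d
    m≢0 : NonZero m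
    m≢0 = ℕ.m*n≢0⇒m≢0 m {{ℕ.>-nonZero 0<md}}
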